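{- For every positive integer $n$, $$L_{0^n}(x;q,t) = \frac{1}{1-q}\, L_{10^{n-1}}(x;q,t),$$ where $0^n$ denotes the word of $n$ zeros and $10^{n-1}$ the word consisting of a $1$ followed by $n-1$ zeros.
   Context: Let $\mathbb{N}=\{0,1,2,\dots\}$ and $\mathbb{P}=\{1,2,3,\dots\}$, and let $x=(x_1,x_2,\dots)$ be commuting variables. For $\gamma\in\mathbb{N}^n$ and $\pi\in\mathbb{P}^n$ define $\operatorname{area}(\gamma)=|\gamma|-\#\{1\le i\le n:\gamma_i>0\}$ (where $|\gamma|=\gamma_1+\dots+\gamma_n$), $\operatorname{dinv}(\gamma,\pi)=\#\{1\le i<j\le n:\gamma_i=\gamma_j,\ \pi_i>\pi_j\}+\#\{1\le i<j\le n:\gamma_i+1=\gamma_j,\ \pi_i<\pi_j\}$, and $x^\pi=\prod_{i=1}^n x_{\pi_i}$. For $v\in\{0,1\}^n$ define the formal series $$L_v(x;q,t)=\sum_{\substack{\gamma\in\mathbb{N}^n,\ \pi\in\mathbb{P}^n\\ \gamma_i=0\iff v_i=1}} q^{\operatorname{area}(\gamma)}t^{\operatorname{dinv}(\gamma,\pi)}x^\pi .$$ The factor $\frac{1}{1-q}$ is interpreted as the formal power series $\sum_{k\ge0}q^k$. -}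

module Defs where

open import Data.Nat using (ℕ; zero; suc; _+_; _∸_; _≡ᵇ_; _<ᵇ_; _⊔_)
open import Data.Bool using (Bool; true; false; _∧_; _∨_; if_then_else_; not)
open import Data.List as L using (List; []; _∷_; filter; length; concatMap; upTo; _++_)
open import Data.Vec as V using (Vec; []; _∷_)
open import Data.Product using (_×_; _,_; proj₁; proj₂)
open import Relation.Nullary.Decidable using (does)
open import Data.Bool.Properties using (_≟_)

[_] : Bool → ℕ
[ true ] = 1
[ false ] = 0

total : ∀ {n} → Vec ℕ n → ℕ
total = V.foldr _ _+_ 0

numPos : ∀ {n} → Vec ℕ n → ℕ
numPos [] = 0
numPos (g ∷ γ) = [ 0 <ᵇ g ] + numPos γ

area : ∀ {n} → Vec ℕ n → ℕ
area γ = total γ ∸ numPos γ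

dinvHead : ∀ {n} → ℕ → ℕ → Vec ℕ n → Vec ℕ n → ℕ
dinvHead g p [] [] = 0
dinvHead g p (h ∷ γ) (r ∷ π) =
  [ (g ≡ᵇ h) ∧ (r <ᵇ p) ] + [ (suc g ≡ᵇ h) ∧ (p <ᵇ r) ] + dinvHead g p γ π

-- dinv(γ,π) = #{i<j : γ_i = γ_j, π_i > π_j} + #{i<j : γ_i + 1 = γ_j, π_i < π_j}
dinv : ∀ {n} → Vec ℕ n → Vec ℕ n → ℕ
dinv [] [] = 0
dinv (g ∷ γ) (p ∷ π) = dinvHead g p γ π + dinv γ π

-- multiplicity of the value j in a word (= exponent of x_j in x^π)
mult : ∀ {n} → ℕ → Vec ℕ n → ℕ
mult j [] = 0
mult j (p ∷ π) = [ j ≡ᵇ p ] + mult j π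

allL : List ℕ → (ℕ → Bool) → Bool
allL [] f = true
allL (x ∷ xs) f = f x ∧ allL xs f

sameMonomial : ∀ {n} → Vec ℕ n → Vec ℕ n → Bool
sameMonomial π w = allL (V.toList π ++ V.toList w) (λ j → mult j π ≡ᵇ mult j w)

-- the support condition  γ_i = 0 ⟺ v_i = 1   (v_i = true encodes v_i = 1)
supportOK : ∀ {n} → Vec Bool n → Vec ℕ n → Bool
supportOK [] [] = true
supportOK (b ∷ v) (g ∷ γ) = does ((g ≡ᵇ 0) ≟ b) ∧ supportOK v γ

vecsFrom : List ℕ → (n : ℕ) → List (Vec ℕ n)
vecsFrom xs zero = [] ∷ []
vecsFrom xs (suc n) = concatMap (λ x → L.map (x ∷_) (vecsFrom xs n)) xs

maxEntry : ∀ {n} → Vec ℕ n → ℕ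
maxEntry = V.foldr _ _⊔_ 0

-- Every (γ,π) with area γ = a has all γ_i ≤ a+1, and every π with x^π = x^w
-- has entries among those of w, so no contributing pair is missed.
candidates : ∀ {n} → ℕ → Vec ℕ n → List (Vec ℕ n × Vec ℕ n)
candidates {n} a w =
  concatMap (λ γ → L.map (γ ,_) (vecsFrom (L.map suc (upTo (maxEntry w))) n))
            (vecsFrom (upTo (suc (suc a))) n)

-- coefficient of q^a t^d x^w in L_v(x;q,t):
-- #{(γ,π) ∈ ℕ^n × ℙ^n : γ_i = 0 ⟺ v_i = 1, area γ = a, dinv(γ,π) = d, x^π = x^w}
coeffL : ∀ {n} → Vec Bool n → (a d : ℕ) → Vec ℕ n → ℕ
coeffL v a d w = length (filter (λ gp → ok gp ≟ true) (candidates a w))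
  where
  ok : _ → Bool
  ok (γ , π) = supportOK v γ ∧ (area γ ≡ᵇ a) ∧ (dinv γ π ≡ᵇ d) ∧ sameMonomial π w

sumBelow : ℕ → (ℕ → ℕ) → ℕ
sumBelow zero f = 0
sumBelow (suc m) f = sumBelow m f + f m

module Submission where

-- Fix dinv d and monomial x^w.  Let  P_a  be the contributing pairs (γ,π)
-- with support 0^{n+1} (all entries of γ positive) and area a, and  Z_a
-- those with support 1 0^n (γ₁ = 0, the rest positive) and area a.  The
-- rotation  (g ∷ γ , p ∷ π) ↦ (γ ∷ʳ (g+1) , π ∷ʳ p)  preserves x^π and dinv
-- (the pairs involving the first position become the pairs involving the
-- last one), and since area γ = Σᵢ (γᵢ ∸ 1) it raises the area by one when
-- g > 0 and keeps it when g = 0.  It is therefore a bijection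
--            P_{a-1} ⊎ Z_a  ≅  P_a ,
-- the image of Z_a being the pairs whose last entry is 1.  Hence
-- |P_a| = |P_{a-1}| + |Z_a|, i.e. |P_a| = Σ_{k ≤ a} |Z_k|.

open import Defs
open import Data.Nat using (ℕ; zero; suc; pred; _+_; _≤_; _≥_; z≤n; s≤s; _≡ᵇ_; _<ᵇ_)
open import Data.Nat.Properties
  using (+-∸-assoc; +-assoc; +-comm; +-commutativeSemigroup; ≤-trans; ≤-antisym; ≤-reflexive;
         m≤m+n; m≤n+m; suc-injective; ≡ᵇ⇒≡; ≡⇒≡ᵇ)
open import Data.Bool using (Bool; true; false; T; _∧_)
open import Data.Bool.Properties using (_≟_; ∧-assoc; ∧-comm; ∧-identityʳ; ∧-commutativeMonoid; T-≡; T-∧)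
open import Data.List as L using (List; []; _∷_; _++_; length; filter; upTo; concatMap;
                                  cartesianProductWith; cartesianProduct)
open import Data.List.Properties using (length-map; length-++; length-removeAt′)
open import Data.List.Membership.Propositional using (_∈_)
open import Data.List.Membership.Propositional.Properties
  using (∈-map⁺; ∈-map⁻; ∈-filter⁺; ∈-filter⁻; ∈-++⁺ˡ; ∈-++⁺ʳ; ∈-++⁻; ∈-upTo⁺;
         ∈-cartesianProductWith⁺; ∈-cartesianProductWith⁻;
         ∈-cartesianProduct⁺; ∈-cartesianProduct⁻)
open import Data.List.Relation.Binary.Subset.Propositional using (_⊆_)
open import Data.List.Relation.Unary.Any using (here; there; index; _─_)
open import Data.List.Relation.Unary.AllPairs using ([]; _∷_)
import Data.List.Relation.Unary.All as ListAll
open import Data.List.Relation.Unary.Unique.Propositional using (Unique)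
import Data.List.Relation.Unary.Unique.Propositional.Properties as Unique
open import Data.Vec as V using (Vec; []; _∷_; _∷ʳ_; replicate; initLast)
open import Data.Vec.Properties using (∷-injective; ∷ʳ-injective; toList-∷ʳ)
open import Data.Vec.Relation.Unary.All as All using (All; []; _∷_)
open import Data.Product using (_×_; _,_; proj₁; proj₂; ∃-syntax)
open import Data.Sum using (inj₁; inj₂)
open import Data.Empty using (⊥; ⊥-elim)
open import Relation.Nullary using (¬_)
open import Function using (id)
open import Relation.Nullary.Decidable using (does)
open import Function.Bundles using (_⇔_; mk⇔; Equivalence)
open import Algebra.Bundles using (CommutativeMonoid)
import Algebra.Properties.CommutativeSemigroup as CommSemigroupProperties
open import Relation.Binary.PropositionalEquality
  using (_≡_; _≢_; refl; sym; trans; cong; cong₂; subst; module ≡-Reasoning)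

open Equivalence using (to; from)
open ≡-Reasoning

module +-Props = CommSemigroupProperties +-commutativeSemigroup
module ∧-Props =
  CommSemigroupProperties (CommutativeMonoid.commutativeSemigroup ∧-commutativeMonoid)

module _ {A : Set} where

  ∈-─ : ∀ {x y : A} {ys} (x∈ys : x ∈ ys) → y ∈ ys → y ≢ x → y ∈ (ys ─ x∈ys)
  ∈-─ (here refl) (here refl)  y≢x = ⊥-elim (y≢x refl)
  ∈-─ (here refl) (there y∈ys) _   = y∈ys
  ∈-─ (there _)   (here refl)  _   = here refl
  ∈-─ (there x∈ys) (there y∈ys) y≢x = there (∈-─ x∈ys y∈ys y≢x)

  unique-length-≤ : ∀ {xs ys : List A} → Unique xs → xs ⊆ ys → length xs ≤ length ys
  unique-length-≤ {[]}     _              _   = z≤n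
  unique-length-≤ {x ∷ xs} {ys} (x∉xs ∷ uxs) xs⊆ys =
    ≤-trans (s≤s (unique-length-≤ uxs xs⊆rest))
            (≤-reflexive (sym (length-removeAt′ ys (index x∈ys))))
    where
    x∈ys : x ∈ ys
    x∈ys = xs⊆ys (here refl)
    xs⊆rest : xs ⊆ (ys ─ x∈ys)
    xs⊆rest z∈xs = ∈-─ x∈ys (xs⊆ys (there z∈xs)) (λ z≡x → ListAll.lookup x∉xs z∈xs (sym z≡x))

length-by-bijection : ∀ {A B : Set} {xs : List A} {zs : List B} (f : A → B) →
  (∀ {x y} → f x ≡ f y → x ≡ y) → Unique xs → Unique zs →
  (∀ {x} → x ∈ xs → f x ∈ zs) → (∀ {z} → z ∈ zs → ∃[ x ] x ∈ xs × f x ≡ z) →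
  length zs ≡ length xs
length-by-bijection {xs = xs} {zs} f f-inj uxs uzs into onto = ≤-antisym
  (≤-trans (unique-length-≤ uzs zs⊆image) (≤-reflexive (length-map f xs)))
  (≤-trans (≤-reflexive (sym (length-map f xs))) (unique-length-≤ (Unique.map⁺ f-inj uxs) image⊆zs))
  where
  zs⊆image : zs ⊆ L.map f xs
  zs⊆image z∈zs with onto z∈zs
  ... | x , x∈xs , refl = ∈-map⁺ f x∈xs
  image⊆zs : L.map f xs ⊆ zs
  image⊆zs z∈image with ∈-map⁻ f z∈image
  ... | x , x∈xs , refl = into x∈xs

-- Coefficientwise multiplication by 1/(1-q): a sequence with L₀ = C₀ and
-- L_{a+1} = L_a + C_{a+1} is the sequence of partial sums of C.
partial-sums : (L C : ℕ → ℕ) → L 0 ≡ C 0 → (∀ a → L (suc a) ≡ L a + C (suc a)) →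
  ∀ a → L a ≡ sumBelow (suc a) C
partial-sums L C base step zero    = base
partial-sums L C base step (suc a) =
  trans (step a) (cong (_+ C (suc a)) (partial-sums L C base step a))

concatMap-map : ∀ {A B C : Set} (f : A → B → C) (xs : List A) (ys : List B) →
  concatMap (λ x → L.map (f x) ys) xs ≡ cartesianProductWith f xs ys
concatMap-map f []       ys = refl
concatMap-map f (x ∷ xs) ys = cong (L.map (f x) ys ++_) (concatMap-map f xs ys)

unique-vecsFrom : ∀ {xs} → Unique xs → ∀ m → Unique (vecsFrom xs m)
unique-vecsFrom uxs zero    = ListAll.[] ∷ []
unique-vecsFrom {xs} uxs (suc m) = subst Unique (sym (concatMap-map _∷_ xs (vecsFrom xs m)))
  (Unique.cartesianProductWith⁺ _∷_ ∷-injective uxs (unique-vecsFrom uxs m))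

∈-vecsFrom⁺ : ∀ {xs m} {v : Vec ℕ m} → All (_∈ xs) v → v ∈ vecsFrom xs m
∈-vecsFrom⁺ []                       = here refl
∈-vecsFrom⁺ {xs} {suc m} (x∈ ∷ v∈) = subst (_ ∈_) (sym (concatMap-map _∷_ xs (vecsFrom xs m)))
  (∈-cartesianProductWith⁺ _∷_ x∈ (∈-vecsFrom⁺ v∈))

∈-vecsFrom⁻ : ∀ {xs} m {v : Vec ℕ m} → v ∈ vecsFrom xs m → All (_∈ xs) v
∈-vecsFrom⁻ zero    {[]} _ = []
∈-vecsFrom⁻ {xs} (suc m) {v} v∈
  with ∈-cartesianProductWith⁻ _∷_ xs (vecsFrom xs m)
         (subst (v ∈_) (concatMap-map _∷_ xs (vecsFrom xs m)) v∈)
... | _ , _ , x∈ , u∈ , refl = x∈ ∷ ∈-vecsFrom⁻ m u∈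

alphabet : ∀ {m} → Vec ℕ m → List ℕ
alphabet w = L.map suc (upTo (maxEntry w))

candidates-≡ : ∀ {m} a (w : Vec ℕ m) →
  candidates a w ≡ cartesianProduct (vecsFrom (upTo (suc (suc a))) m) (vecsFrom (alphabet w) m)
candidates-≡ {m} a w = concatMap-map _,_ (vecsFrom (upTo (suc (suc a))) m) (vecsFrom (alphabet w) m)

unique-candidates : ∀ {m} a (w : Vec ℕ m) → Unique (candidates a w)
unique-candidates {m} a w = subst Unique (sym (candidates-≡ a w))
  (Unique.cartesianProduct⁺ (unique-vecsFrom (Unique.upTo⁺ (suc (suc a))) m)
                            (unique-vecsFrom (Unique.map⁺ suc-injective (Unique.upTo⁺ (maxEntry w))) m))

∈-candidates⁺ : ∀ {m} a (w : Vec ℕ m) {γ π} →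
  All (_≤ suc a) γ → All (_∈ alphabet w) π → (γ , π) ∈ candidates a w
∈-candidates⁺ a w γ≤ π∈ = subst (_ ∈_) (sym (candidates-≡ a w))
  (∈-cartesianProduct⁺ (∈-vecsFrom⁺ (All.map (λ g≤ → ∈-upTo⁺ (s≤s g≤)) γ≤)) (∈-vecsFrom⁺ π∈))

∈-candidates⁻ : ∀ {m} a (w : Vec ℕ m) {γ π} → (γ , π) ∈ candidates a w → All (_∈ alphabet w) π
∈-candidates⁻ {m} a w {γ} {π} mem =
  ∈-vecsFrom⁻ m (proj₂ (∈-cartesianProduct⁻ (vecsFrom (upTo (suc (suc a))) m) _
                        (subst ((γ , π) ∈_) (candidates-≡ a w) mem)))

All-∷ʳ⁺ : ∀ {A : Set} {P : A → Set} {m} {xs : Vec A m} {x} → All P xs → P x → All P (xs ∷ʳ x)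
All-∷ʳ⁺ []         px = px ∷ []
All-∷ʳ⁺ (py ∷ pys) px = py ∷ All-∷ʳ⁺ pys px

All-∷ʳ⁻ : ∀ {A : Set} {P : A → Set} {m} (xs : Vec A m) {x} → All P (xs ∷ʳ x) → All P (x ∷ xs)
All-∷ʳ⁻ []       (px ∷ [])  = px ∷ []
All-∷ʳ⁻ (y ∷ ys) (py ∷ pys) with All-∷ʳ⁻ ys pys
... | px ∷ pys′ = px ∷ py ∷ pys′

-- Area:  area γ = Σᵢ (γᵢ ∸ 1), so it is invariant under rotation

-- Each positive entry contributes at least 1 to |γ|, so the subtraction in
-- the definition of area is exact.
numPos≤total : ∀ {m} (γ : Vec ℕ m) → numPos γ ≤ total γ
numPos≤total []          = z≤n
numPos≤total (zero  ∷ γ) = numPos≤total γ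
numPos≤total (suc g ∷ γ) = s≤s (≤-trans (numPos≤total γ) (m≤n+m (total γ) g))

area-∷ : ∀ {m} g (γ : Vec ℕ m) → area (g ∷ γ) ≡ pred g + area γ
area-∷ zero    γ = refl
area-∷ (suc g) γ = +-∸-assoc g (numPos≤total γ)

area-∷ʳ : ∀ {m} (γ : Vec ℕ m) g → area (γ ∷ʳ g) ≡ area (g ∷ γ)
area-∷ʳ []      g = refl
area-∷ʳ (h ∷ γ) g = begin
  area (h ∷ (γ ∷ʳ g))           ≡⟨ area-∷ h (γ ∷ʳ g) ⟩
  pred h + area (γ ∷ʳ g)        ≡⟨ cong (pred h +_) (trans (area-∷ʳ γ g) (area-∷ g γ)) ⟩
  pred h + (pred g + area γ)    ≡⟨ +-Props.x∙yz≈y∙xz (pred h) (pred g) (area γ) ⟩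
  pred g + (pred h + area γ)    ≡⟨ cong (pred g +_) (sym (area-∷ h γ)) ⟩
  pred g + area (h ∷ γ)         ≡⟨ sym (area-∷ g (h ∷ γ)) ⟩
  area (g ∷ h ∷ γ)              ∎

area-raise : ∀ {m} k (γ : Vec ℕ m) → area (suc (suc k) ∷ γ) ≡ suc (area (suc k ∷ γ))
area-raise k γ = trans (area-∷ (suc (suc k)) γ) (cong suc (sym (area-∷ (suc k) γ)))

-- Every entry is at most 1 + area; this places each γ of area a among the
-- candidates {0,…,a+1}ⁿ.
area-bound : ∀ {m} (γ : Vec ℕ m) → All (_≤ suc (area γ)) γ
area-bound []      = []
area-bound (g ∷ γ) = subst (λ b → All (_≤ suc b) (g ∷ γ)) (sym (area-∷ g γ))
  (head-bound g ∷ All.map (λ e≤ → ≤-trans e≤ (s≤s (m≤n+m (area γ) (pred g)))) (area-bound γ))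
  where
  head-bound : ∀ g → g ≤ suc (pred g + area γ)
  head-bound zero    = z≤n
  head-bound (suc g) = s≤s (m≤m+n g (area γ))

-- The test performed by supportOK at a position where v has a 0.
isPositive : ℕ → Bool
isPositive g = does ((g ≡ᵇ 0) ≟ false)

allPositive-∷ʳ : ∀ {m} (γ : Vec ℕ m) g →
  supportOK (replicate (suc m) false) (γ ∷ʳ g) ≡ supportOK (replicate (suc m) false) (g ∷ γ)
allPositive-∷ʳ []      g = refl
allPositive-∷ʳ (h ∷ γ) g = trans (cong (isPositive h ∧_) (allPositive-∷ʳ γ g))
  (∧-Props.x∙yz≈y∙xz (isPositive h) (isPositive g) (supportOK (replicate _ false) γ))

-- Contribution of a pair of positions i < j carrying (γᵢ,πᵢ) = (g,p), (γⱼ,πⱼ) = (h,r).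
dinvPair : ℕ → ℕ → ℕ → ℕ → ℕ
dinvPair g p h r = [ (g ≡ᵇ h) ∧ (r <ᵇ p) ] + [ (suc g ≡ᵇ h) ∧ (p <ᵇ r) ]

dinvLast : ∀ {m} → ℕ → ℕ → Vec ℕ m → Vec ℕ m → ℕ
dinvLast x y []      []      = 0
dinvLast x y (h ∷ γ) (r ∷ π) = dinvPair h r x y + dinvLast x y γ π

dinvHead-∷ʳ : ∀ {m} g p (γ π : Vec ℕ m) x y →
  dinvHead g p (γ ∷ʳ x) (π ∷ʳ y) ≡ dinvHead g p γ π + dinvPair g p x y
dinvHead-∷ʳ g p []      []      x y = +-comm (dinvPair g p x y) 0
dinvHead-∷ʳ g p (h ∷ γ) (r ∷ π) x y = trans (cong (dinvPair g p h r +_) (dinvHead-∷ʳ g p γ π x y))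
  (sym (+-assoc (dinvPair g p h r) (dinvHead g p γ π) (dinvPair g p x y)))

dinv-∷ʳ : ∀ {m} (γ π : Vec ℕ m) x y → dinv (γ ∷ʳ x) (π ∷ʳ y) ≡ dinv γ π + dinvLast x y γ π
dinv-∷ʳ []      []      x y = refl
dinv-∷ʳ (h ∷ γ) (r ∷ π) x y = trans (cong₂ _+_ (dinvHead-∷ʳ h r γ π x y) (dinv-∷ʳ γ π x y))
  (+-Props.interchange (dinvHead h r γ π) (dinvPair h r x y) (dinv γ π) (dinvLast x y γ π))

≡ᵇ-comm : ∀ m n → (m ≡ᵇ n) ≡ (n ≡ᵇ m)
≡ᵇ-comm zero    zero    = refl
≡ᵇ-comm zero    (suc n) = refl
≡ᵇ-comm (suc m) zero    = refl
≡ᵇ-comm (suc m) (suc n) = ≡ᵇ-comm m n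

dinvPair-rotate : ∀ g p h r → dinvPair h r (suc g) p ≡ dinvPair g p h r
dinvPair-rotate g p h r
  rewrite ≡ᵇ-comm h (suc g) | ≡ᵇ-comm h g = +-comm [ (suc g ≡ᵇ h) ∧ (p <ᵇ r) ] _

dinvLast-rotate : ∀ {m} g p (γ π : Vec ℕ m) → dinvLast (suc g) p γ π ≡ dinvHead g p γ π
dinvLast-rotate g p []      []      = refl
dinvLast-rotate g p (h ∷ γ) (r ∷ π) = cong₂ _+_ (dinvPair-rotate g p h r) (dinvLast-rotate g p γ π)

dinv-rotate : ∀ {m} g p (γ π : Vec ℕ m) → dinv (γ ∷ʳ suc g) (π ∷ʳ p) ≡ dinv (g ∷ γ) (p ∷ π)
dinv-rotate g p γ π = begin
  dinv (γ ∷ʳ suc g) (π ∷ʳ p)         ≡⟨ dinv-∷ʳ γ π (suc g) p ⟩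
  dinv γ π + dinvLast (suc g) p γ π  ≡⟨ cong (dinv γ π +_) (dinvLast-rotate g p γ π) ⟩
  dinv γ π + dinvHead g p γ π        ≡⟨ +-comm (dinv γ π) (dinvHead g p γ π) ⟩
  dinvHead g p γ π + dinv γ π        ∎

mult-rotate : ∀ {m} j (π : Vec ℕ m) p → mult j (π ∷ʳ p) ≡ mult j (p ∷ π)
mult-rotate j []      p = refl
mult-rotate j (q ∷ π) p = trans (cong ([ j ≡ᵇ q ] +_) (mult-rotate j π p))
  (+-Props.x∙yz≈y∙xz [ j ≡ᵇ q ] [ j ≡ᵇ p ] (mult j π))

allL-cong : ∀ xs {f g : ℕ → Bool} → (∀ j → f j ≡ g j) → allL xs f ≡ allL xs g
allL-cong []       f≗g = refl
allL-cong (x ∷ xs) f≗g = cong₂ _∧_ (f≗g x) (allL-cong xs f≗g)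

allL-++ : ∀ xs ys f → allL (xs ++ ys) f ≡ allL xs f ∧ allL ys f
allL-++ []       ys f = refl
allL-++ (x ∷ xs) ys f = trans (cong (f x ∧_) (allL-++ xs ys f)) (sym (∧-assoc (f x) _ _))

allL-rotate : ∀ {m} (π : Vec ℕ m) p f → allL (V.toList (π ∷ʳ p)) f ≡ allL (V.toList (p ∷ π)) f
allL-rotate π p f = begin
  allL (V.toList (π ∷ʳ p)) f               ≡⟨ cong (λ l → allL l f) (toList-∷ʳ p π) ⟩
  allL (V.toList π ++ p ∷ []) f            ≡⟨ allL-++ (V.toList π) (p ∷ []) f ⟩
  allL (V.toList π) f ∧ (f p ∧ true)       ≡⟨ cong (allL (V.toList π) f ∧_) (∧-identityʳ (f p)) ⟩
  allL (V.toList π) f ∧ f p                ≡⟨ ∧-comm (allL (V.toList π) f) (f p) ⟩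
  f p ∧ allL (V.toList π) f                ∎

sameMonomial-rotate : ∀ {m} (π : Vec ℕ m) p (w : Vec ℕ (suc m)) →
  sameMonomial (π ∷ʳ p) w ≡ sameMonomial (p ∷ π) w
sameMonomial-rotate π p w = begin
  allL (V.toList (π ∷ʳ p) ++ V.toList w) (λ j → mult j (π ∷ʳ p) ≡ᵇ mult j w)
    ≡⟨ allL-cong (V.toList (π ∷ʳ p) ++ V.toList w) (λ j → cong (_≡ᵇ mult j w) (mult-rotate j π p)) ⟩
  allL (V.toList (π ∷ʳ p) ++ V.toList w) same
    ≡⟨ allL-++ (V.toList (π ∷ʳ p)) (V.toList w) same ⟩
  allL (V.toList (π ∷ʳ p)) same ∧ allL (V.toList w) same
    ≡⟨ cong (_∧ allL (V.toList w) same) (allL-rotate π p same) ⟩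
  allL (V.toList (p ∷ π)) same ∧ allL (V.toList w) same
    ≡⟨ sym (allL-++ (V.toList (p ∷ π)) (V.toList w) same) ⟩
  allL (V.toList (p ∷ π) ++ V.toList w) same ∎
  where
  same : ℕ → Bool
  same j = mult j (p ∷ π) ≡ᵇ mult j w

module Terms {m} (d : ℕ) (w : Vec ℕ m) where

  termOK : Vec Bool m → ℕ → Vec ℕ m × Vec ℕ m → Bool
  termOK v a (γ , π) = supportOK v γ ∧ (area γ ≡ᵇ a) ∧ (dinv γ π ≡ᵇ d) ∧ sameMonomial π w

  terms : Vec Bool m → ℕ → List (Vec ℕ m × Vec ℕ m)
  terms v a = filter (λ x → termOK v a x ≟ true) (candidates a w)

  record Term (v : Vec Bool m) (a : ℕ) (γ π : Vec ℕ m) : Set where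
    field
      support    : T (supportOK v γ)
      area≡      : area γ ≡ a
      dinv≡      : dinv γ π ≡ d
      monomial   : T (sameMonomial π w)
      inAlphabet : All (_∈ alphabet w) π
  open Term public

  unique-terms : ∀ v a → Unique (terms v a)
  unique-terms v a = Unique.filter⁺ _ (unique-candidates a w)

  ∈-terms⁻ : ∀ v a {γ π} → (γ , π) ∈ terms v a → Term v a γ π
  ∈-terms⁻ v a {γ} {π} mem
    with ∈-filter⁻ (λ x → termOK v a x ≟ true) mem
  ... | inCandidates , ok
    with to T-∧ (from T-≡ ok)
  ... | sup , rest₁ with to T-∧ rest₁
  ... | ar , rest₂ with to T-∧ rest₂
  ... | di , mono = record
    { support    = sup
    ; area≡      = ≡ᵇ⇒≡ (area γ) a ar
    ; dinv≡      = ≡ᵇ⇒≡ (dinv γ π) d di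
    ; monomial   = mono
    ; inAlphabet = ∈-candidates⁻ a w inCandidates
    }

  ∈-terms⁺ : ∀ {v a γ π} → Term v a γ π → (γ , π) ∈ terms v a
  ∈-terms⁺ {v} {a} {γ} {π} t = ∈-filter⁺ (λ x → termOK v a x ≟ true)
    (∈-candidates⁺ a w (subst (λ b → All (_≤ suc b) γ) (area≡ t) (area-bound γ)) (inAlphabet t))
    (to T-≡ (from T-∧ (support t , from T-∧ (≡⇒≡ᵇ (area γ) a (area≡ t) ,
                                             from T-∧ (≡⇒≡ᵇ (dinv γ π) d (dinv≡ t) , monomial t)))))

-- The rotation bijection

module Rotation (n d : ℕ) (w : Vec ℕ (suc n)) where
  open Terms d w

  Pair : Set
  Pair = Vec ℕ (suc n) × Vec ℕ (suc n)

  allPositive : Vec Bool (suc n)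
  allPositive = replicate (suc n) false

  headZero : Vec Bool (suc n)
  headZero = true ∷ replicate n false

  rotate : Pair → Pair
  rotate (g ∷ γ , p ∷ π) = (γ ∷ʳ suc g , π ∷ʳ p)

  rotate-injective : ∀ {x y} → rotate x ≡ rotate y → x ≡ y
  rotate-injective {g ∷ γ , p ∷ π} {h ∷ δ , r ∷ ρ} eq
    with ∷ʳ-injective γ δ (cong proj₁ eq) | ∷ʳ-injective π ρ (cong proj₂ eq)
  ... | refl , refl | refl , refl = refl

  rotate-Term : ∀ {v a a′} g (γ : Vec ℕ n) p π →
    supportOK v (g ∷ γ) ≡ supportOK allPositive (suc g ∷ γ) →
    (area (g ∷ γ) ≡ a ⇔ area (suc g ∷ γ) ≡ a′) →
    Term v a (g ∷ γ) (p ∷ π) ⇔ Term allPositive a′ (γ ∷ʳ suc g) (π ∷ʳ p)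
  rotate-Term {v} g γ p π sup ar = mk⇔ forward backward
    where
    support-rotate : supportOK allPositive (γ ∷ʳ suc g) ≡ supportOK v (g ∷ γ)
    support-rotate = trans (allPositive-∷ʳ γ (suc g)) (sym sup)

    forward : Term v _ (g ∷ γ) (p ∷ π) → Term allPositive _ (γ ∷ʳ suc g) (π ∷ʳ p)
    forward t = record
      { support    = subst T (sym support-rotate) (support t)
      ; area≡      = trans (area-∷ʳ γ (suc g)) (to ar (area≡ t))
      ; dinv≡      = trans (dinv-rotate g p γ π) (dinv≡ t)
      ; monomial   = subst T (sym (sameMonomial-rotate π p w)) (monomial t)
      ; inAlphabet = All-∷ʳ⁺ (All.tail (inAlphabet t)) (All.head (inAlphabet t))
      }

    backward : Term allPositive _ (γ ∷ʳ suc g) (π ∷ʳ p) → Term v _ (g ∷ γ) (p ∷ π)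
    backward t = record
      { support    = subst T support-rotate (support t)
      ; area≡      = from ar (trans (sym (area-∷ʳ γ (suc g))) (area≡ t))
      ; dinv≡      = trans (sym (dinv-rotate g p γ π)) (dinv≡ t)
      ; monomial   = subst T (sameMonomial-rotate π p w) (monomial t)
      ; inAlphabet = All-∷ʳ⁻ π (inAlphabet t)
      }

  shift-Term : ∀ {a} k (γ : Vec ℕ n) p π →
    Term allPositive a (suc k ∷ γ) (p ∷ π) ⇔ Term allPositive (suc a) (γ ∷ʳ suc (suc k)) (π ∷ʳ p)
  shift-Term k γ p π = rotate-Term (suc k) γ p π refl
    (mk⇔ (λ e → trans (area-raise k γ) (cong suc e))
         (λ e → suc-injective (trans (sym (area-raise k γ)) e)))

  lift-Term : ∀ {a} (γ : Vec ℕ n) p π →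
    Term headZero a (0 ∷ γ) (p ∷ π) ⇔ Term allPositive a (γ ∷ʳ 1) (π ∷ʳ p)
  lift-Term γ p π = rotate-Term 0 γ p π refl (mk⇔ id id)

  previous : ℕ → List Pair
  previous zero    = []
  previous (suc a) = terms allPositive a

  sources : ℕ → List Pair
  sources a = previous a ++ terms headZero a

  unique-sources : ∀ a → Unique (sources a)
  unique-sources a = Unique.++⁺ (unique-previous a) (unique-terms headZero a) disjoint
    where
    unique-previous : ∀ a → Unique (previous a)
    unique-previous zero    = []
    unique-previous (suc a) = unique-terms allPositive a

    -- The first entry is positive on the left and zero on the right.
    separated : ∀ a x → x ∈ previous a → x ∈ terms headZero a → ⊥
    separated (suc a) (zero  ∷ γ , p ∷ π) x∈ _  = support (∈-terms⁻ allPositive a x∈)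
    separated (suc a) (suc g ∷ γ , p ∷ π) _  x∈ = support (∈-terms⁻ headZero (suc a) x∈)

    disjoint : ∀ {x} → ¬ (x ∈ previous a × x ∈ terms headZero a)
    disjoint {x} (x∈₁ , x∈₂) = separated a x x∈₁ x∈₂

  rotate-into : ∀ a x → x ∈ sources a → rotate x ∈ terms allPositive a
  rotate-into a x x∈ with ∈-++⁻ (previous a) x∈
  rotate-into zero _ _ | inj₁ ()
  rotate-into (suc a) (zero  ∷ γ , p ∷ π) _ | inj₁ x∈ =
    ⊥-elim (support (∈-terms⁻ allPositive a x∈))
  rotate-into (suc a) (suc k ∷ γ , p ∷ π) _ | inj₁ x∈ =
    ∈-terms⁺ (to (shift-Term k γ p π) (∈-terms⁻ allPositive a x∈))
  rotate-into a (zero  ∷ γ , p ∷ π) _ | inj₂ x∈ =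
    ∈-terms⁺ (to (lift-Term γ p π) (∈-terms⁻ headZero a x∈))
  rotate-into a (suc k ∷ γ , p ∷ π) _ | inj₂ x∈ =
    ⊥-elim (support (∈-terms⁻ headZero a x∈))

  -- Every term of L_{0^{n+1}} is a rotation: split off its last entry l;
  -- l = 1 comes from L_{1 0^n}, l ≥ 2 from a term of smaller area.
  unrotate : ∀ a γ π → Term allPositive a γ π → ∃[ y ] y ∈ sources a × rotate y ≡ (γ , π)
  unrotate a γ π t with initLast γ | initLast π
  ... | δ , l , refl | ρ , r , refl = from-last a l t
    where
    from-last : ∀ a l → Term allPositive a (δ ∷ʳ l) (ρ ∷ʳ r) →
      ∃[ y ] y ∈ sources a × rotate y ≡ (δ ∷ʳ l , ρ ∷ʳ r)
    from-last a zero t = ⊥-elim (subst T (allPositive-∷ʳ δ 0) (support t))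
    from-last a (suc zero) t =
      (0 ∷ δ , r ∷ ρ) , ∈-++⁺ʳ (previous a) (∈-terms⁺ (from (lift-Term δ r ρ) t)) , refl
    from-last zero (suc (suc k)) t
      with trans (sym (trans (area-∷ʳ δ (suc (suc k))) (area-raise k δ))) (area≡ t)
    ... | ()
    from-last (suc a) (suc (suc k)) t =
      (suc k ∷ δ , r ∷ ρ) , ∈-++⁺ˡ (∈-terms⁺ (from (shift-Term k δ r ρ) t)) , refl

  count-step : ∀ a →
    length (terms allPositive a) ≡ length (previous a) + length (terms headZero a)
  count-step a = trans
    (length-by-bijection rotate rotate-injective (unique-sources a) (unique-terms allPositive a)
       (λ {x} → rotate-into a x)
       (λ {z} z∈ → unrotate a (proj₁ z) (proj₂ z) (∈-terms⁻ allPositive a z∈)))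
    (length-++ (previous a))

-- The counting recurrence of the rotation bijection, summed up.
lemma2p4 : (n a d : ℕ) (w : Vec ℕ (suc n)) → All (λ j → j ≥ 1) w →
    coeffL (replicate (suc n) false) a d w
    ≡ sumBelow (suc a) (λ k → coeffL (true ∷ replicate n false) k d w)
lemma2p4 n a d w _ =
  partial-sums (λ k → coeffL allPositive k d w) (λ k → coeffL headZero k d w)
    (count-step zero) (λ k → count-step (suc k)) a
  where open Rotation n d w
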